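{- Assume $\mathsf{CT_Q}$. Let $\mathcal{M}$ be a model of $\mathsf{HA}$ and let $\alpha(x),\beta(x)$ be an $\mathsf{HA}$-inseparable pair of unary formulas. Then the predicates $\lambda n:\mathbb{N}.\ \mathcal{M}\vDash\alpha(\overline{n})$ and $\lambda n:\mathbb{N}.\ \mathcal{M}\vDash\beta(\overline{n})$ are both undecidable.
   Context: Meta-theory: constructive type theory (Calculus of Inductive Constructions), no classical axioms. Arithmetic signature $0,S,+,\times,=$; $\mathsf{HA}$ is Heyting arithmetic (axioms $Sx\neq0$, injectivity of $S$, recursion equations for $+,\times$, equality axioms, induction scheme for all formulas) and $\mathsf{Q}$ is Robinson arithmetic (induction replaced by $\forall x.\,x=0\lor\exists y.\,x=Sy$), both with intuitionistic natural deduction $\vdash$; $\overline{n}=S^n0$ (also its value in a model). A model $\mathcal{M}$ of $\mathsf{HA}$ is a type with interpretations of $0,S,+,\times$, $=$ interpreted as actual equality, satisfying the $\mathsf{HA}$ axioms under Tarski semantics (connectives/quantifiers interpreted type-theoretically). $D:\mathbb{N}\to\mathbb{P}$ is decidable if $\exists f:\mathbb{N}\to\mathbb{B}.\ \forall x.\ D\,x\leftrightarrow f\,x=\mathsf{tt}$; undecidable means not decidable. A pair $\alpha,\beta$ is $\mathsf{HA}$-inseparable if $\mathsf{HA}\vdash\neg\exists x.\,\alpha(x)\land\beta(x)$ and every $D:\mathbb{N}\to\mathbb{P}$ with $\forall n.\ \mathsf{Q}\vdash\alpha(\overline{n})\to D\,n$ and $\forall n.\ \mathsf{Q}\vdash\beta(\overline{n})\to\neg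 D\,n$ is undecidable. $\Delta_1$: for every substitution $\sigma$ of closed terms $\mathsf{Q}\vdash\varphi[\sigma]$ or $\mathsf{Q}\vdash\neg\varphi[\sigma]$; $\Sigma_1$: $\exists x_1\dots\exists x_n.\varphi_0$ with $\varphi_0$ $\Delta_1$. $\mathsf{CT_Q}$ (standing assumption of the paper): for every $f:\mathbb{N}\to\mathbb{N}$ there is a binary $\Sigma_1$-formula $\varphi_f(x,y)$ with $\mathsf{Q}\vdash\forall y.\,\varphi_f(\overline{n},y)\leftrightarrow\overline{f\,n}=y$ for every $n$. -}

module Defs where

open import Data.Nat using (ℕ; zero; suc; _<_)
open import Data.Bool using (Bool; true)
open import Data.List using (List; []; _∷_; map)
open import Data.List.Membership.Propositional using (_∈_)
open import Data.List.Relation.Unary.All using (All)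
open import Data.Product using (Σ; _×_; _,_)
open import Data.Sum using (_⊎_)
open import Data.Empty using (⊥)
open import Relation.Nullary using (¬_)
open import Relation.Binary.PropositionalEquality using (_≡_)

infixl 7 _⊗_
infixl 6 _⊕_
infix  5 _==_
infixr 4 _∧'_
infixr 3 _∨'_
infixr 2 _⇒_ _⇔_

data Term : Set where
  var  : ℕ → Term
  zer  : Term
  suc' : Term → Term
  _⊕_  : Term → Term → Term
  _⊗_  : Term → Term → Term

data Form : Set where
  ⊥'   : Form
  _==_ : Term → Term → Form
  _∧'_ : Form → Form → Form
  _∨'_ : Form → Form → Form
  _⇒_  : Form → Form → Form
  ∀'   : Form → Form
  ∃'   : Form → Form

¬' : Form → Form
¬' φ = φ ⇒ ⊥'

_⇔_ : Form → Form → Form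
φ ⇔ ψ = (φ ⇒ ψ) ∧' (ψ ⇒ φ)

num : ℕ → Term
num zero    = zer
num (suc n) = suc' (num n)

Subst : Set
Subst = ℕ → Term

_∷ₛ_ : Term → Subst → Subst
(t ∷ₛ σ) zero    = t
(t ∷ₛ σ) (suc n) = σ n

substT : Subst → Term → Term
substT σ (var n)  = σ n
substT σ zer      = zer
substT σ (suc' t) = suc' (substT σ t)
substT σ (t ⊕ u)  = substT σ t ⊕ substT σ u
substT σ (t ⊗ u)  = substT σ t ⊗ substT σ u

shiftT : Term → Term
shiftT = substT (λ n → var (suc n))

up : Subst → Subst
up σ = var zero ∷ₛ (λ n → shiftT (σ n))

substF : Subst → Form → Form
substF σ ⊥'       = ⊥'
substF σ (t == u) = substT σ t == substT σ u
substF σ (φ ∧' ψ) = substF σ φ ∧' substF σ ψ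
substF σ (φ ∨' ψ) = substF σ φ ∨' substF σ ψ
substF σ (φ ⇒ ψ)  = substF σ φ ⇒ substF σ ψ
substF σ (∀' φ)   = ∀' (substF (up σ) φ)
substF σ (∃' φ)   = ∃' (substF (up σ) φ)

shiftF : Form → Form
shiftF = substF (λ n → var (suc n))

-- φ[t/x₀] : substitute t for variable 0 (and lower the others)
_[_] : Form → Term → Form
φ [ t ] = substF (t ∷ₛ var) φ

-- Free variables bounded by k (k = 0: closed; 1: unary; 2: binary)

data BoundedT (k : ℕ) : Term → Set where
  bvar  : ∀ {n} → n < k → BoundedT k (var n)
  bzer  : BoundedT k zer
  bsuc  : ∀ {t} → BoundedT k t → BoundedT k (suc' t)
  bplus : ∀ {t u} → BoundedT k t → BoundedT k u → BoundedT k (t ⊕ u)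
  btimes : ∀ {t u} → BoundedT k t → BoundedT k u → BoundedT k (t ⊗ u)

data BoundedF : ℕ → Form → Set where
  b⊥  : ∀ {k} → BoundedF k ⊥'
  b== : ∀ {k t u} → BoundedT k t → BoundedT k u → BoundedF k (t == u)
  b∧  : ∀ {k φ ψ} → BoundedF k φ → BoundedF k ψ → BoundedF k (φ ∧' ψ)
  b∨  : ∀ {k φ ψ} → BoundedF k φ → BoundedF k ψ → BoundedF k (φ ∨' ψ)
  b⇒  : ∀ {k φ ψ} → BoundedF k φ → BoundedF k ψ → BoundedF k (φ ⇒ ψ)
  b∀  : ∀ {k φ} → BoundedF (suc k) φ → BoundedF k (∀' φ)
  b∃  : ∀ {k φ} → BoundedF (suc k) φ → BoundedF k (∃' φ)

ClosedT : Term → Set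
ClosedT = BoundedT 0

infix 1 _⊢_

data _⊢_ : List Form → Form → Set where
  ctx  : ∀ {Γ φ} → φ ∈ Γ → Γ ⊢ φ
  ⊥E   : ∀ {Γ φ} → Γ ⊢ ⊥' → Γ ⊢ φ
  ⇒I   : ∀ {Γ φ ψ} → (φ ∷ Γ) ⊢ ψ → Γ ⊢ φ ⇒ ψ
  ⇒E   : ∀ {Γ φ ψ} → Γ ⊢ φ ⇒ ψ → Γ ⊢ φ → Γ ⊢ ψ
  ∧I   : ∀ {Γ φ ψ} → Γ ⊢ φ → Γ ⊢ ψ → Γ ⊢ φ ∧' ψ
  ∧E₁  : ∀ {Γ φ ψ} → Γ ⊢ φ ∧' ψ → Γ ⊢ φ
  ∧E₂  : ∀ {Γ φ ψ} → Γ ⊢ φ ∧' ψ → Γ ⊢ ψ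
  ∨I₁  : ∀ {Γ φ ψ} → Γ ⊢ φ → Γ ⊢ φ ∨' ψ
  ∨I₂  : ∀ {Γ φ ψ} → Γ ⊢ ψ → Γ ⊢ φ ∨' ψ
  ∨E   : ∀ {Γ φ ψ θ} → Γ ⊢ φ ∨' ψ → (φ ∷ Γ) ⊢ θ → (ψ ∷ Γ) ⊢ θ → Γ ⊢ θ
  ∀I   : ∀ {Γ φ} → map shiftF Γ ⊢ φ → Γ ⊢ ∀' φ
  ∀E   : ∀ {Γ φ} (t : Term) → Γ ⊢ ∀' φ → Γ ⊢ φ [ t ]
  ∃I   : ∀ {Γ φ} (t : Term) → Γ ⊢ φ [ t ] → Γ ⊢ ∃' φ
  ∃E   : ∀ {Γ φ ψ} → Γ ⊢ ∃' φ → (φ ∷ map shiftF Γ) ⊢ shiftF ψ → Γ ⊢ ψ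

Theory : Set₁
Theory = Form → Set

infix 1 _⊩_
_⊩_ : Theory → Form → Set
T ⊩ φ = Σ (List Form) λ Γ → All T Γ × (Γ ⊢ φ)

x₀ x₁ x₂ : Term
x₀ = var 0
x₁ = var 1
x₂ = var 2

data BaseAx : Form → Set where
  ax-zero-succ : BaseAx (∀' (¬' (suc' x₀ == zer)))
  ax-succ-inj  : BaseAx (∀' (∀' (suc' x₁ == suc' x₀ ⇒ x₁ == x₀)))
  ax-add-zero  : BaseAx (∀' (zer ⊕ x₀ == x₀))
  ax-add-rec   : BaseAx (∀' (∀' (suc' x₁ ⊕ x₀ == suc' (x₁ ⊕ x₀))))
  ax-mul-zero  : BaseAx (∀' (zer ⊗ x₀ == zer))
  ax-mul-rec   : BaseAx (∀' (∀' (suc' x₁ ⊗ x₀ == x₀ ⊕ x₁ ⊗ x₀)))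
  ax-refl      : BaseAx (∀' (x₀ == x₀))
  ax-sym       : BaseAx (∀' (∀' (x₁ == x₀ ⇒ x₀ == x₁)))
  ax-trans     : BaseAx (∀' (∀' (∀' (x₂ == x₁ ⇒ x₁ == x₀ ⇒ x₂ == x₀))))
  ax-cong-suc  : BaseAx (∀' (∀' (x₁ == x₀ ⇒ suc' x₁ == suc' x₀)))
  ax-cong-add  : BaseAx (∀' (∀' (∀' (∀' (var 3 == x₂ ⇒ x₁ == x₀ ⇒ var 3 ⊕ x₁ == x₂ ⊕ x₀)))))
  ax-cong-mul  : BaseAx (∀' (∀' (∀' (∀' (var 3 == x₂ ⇒ x₁ == x₀ ⇒ var 3 ⊗ x₁ == x₂ ⊗ x₀)))))

-- induction scheme for every formula φ (x₀ the induction variable,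
-- other free variables are parameters)
induction : Form → Form
induction φ =
  φ [ zer ] ⇒ ∀' (φ ⇒ substF (suc' x₀ ∷ₛ (λ n → var (suc n))) φ) ⇒ ∀' φ

data Q : Form → Set where
  base : ∀ {φ} → BaseAx φ → Q φ
  case : Q (∀' (x₀ == zer ∨' ∃' (x₁ == suc' x₀)))

data HA : Form → Set where
  base : ∀ {φ} → BaseAx φ → HA φ
  ind  : (φ : Form) → HA (induction φ)

record Interp : Set₁ where
  field
    D     : Set
    i0    : D
    iS    : D → D
    iplus : D → D → D
    itimes : D → D → D

module _ (I : Interp) where
  open Interp I

  eval : (ℕ → D) → Term → D
  eval ρ (var n)  = ρ n
  eval ρ zer      = i0
  eval ρ (suc' t) = iS (eval ρ t)
  eval ρ (t ⊕ u)  = iplus (eval ρ t) (eval ρ u)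
  eval ρ (t ⊗ u)  = itimes (eval ρ t) (eval ρ u)

  consEnv : D → (ℕ → D) → ℕ → D
  consEnv d ρ zero    = d
  consEnv d ρ (suc n) = ρ n

  sat : (ℕ → D) → Form → Set
  sat ρ ⊥'       = ⊥
  sat ρ (t == u) = eval ρ t ≡ eval ρ u
  sat ρ (φ ∧' ψ) = sat ρ φ × sat ρ ψ
  sat ρ (φ ∨' ψ) = sat ρ φ ⊎ sat ρ ψ
  sat ρ (φ ⇒ ψ)  = sat ρ φ → sat ρ ψ
  sat ρ (∀' φ)   = (d : D) → sat (consEnv d ρ) φ
  sat ρ (∃' φ)   = Σ D λ d → sat (consEnv d ρ) φ

record ModelHA : Set₁ where
  field
    interp : Interp
    axioms : ∀ φ → HA φ → ∀ ρ → sat interp ρ φ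

_⊨_ : ModelHA → Form → Set
M ⊨ φ = ∀ ρ → sat (ModelHA.interp M) ρ φ

Decidable : (ℕ → Set) → Set
Decidable P = Σ (ℕ → Bool) λ f → ∀ x → (P x → f x ≡ true) × (f x ≡ true → P x)

Undecidable : (ℕ → Set) → Set
Undecidable P = ¬ Decidable P

Δ₁ : Form → Set
Δ₁ φ = (σ : Subst) → (∀ n → ClosedT (σ n)) →
       (Q ⊩ substF σ φ) ⊎ (Q ⊩ ¬' (substF σ φ))

data Σ₁ : Form → Set where
  delta : ∀ {φ} → Δ₁ φ → Σ₁ φ
  ex    : ∀ {φ} → Σ₁ φ → Σ₁ (∃' φ)

-- φ_f(x,y) with x = variable 0, y = variable 1.
-- "∀ y. φ_f(n̄, y) ↔ \overline{f n} = y" :  φ_f[n̄/x₀] has y as x₀, bound by ∀'.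
CT-Q : Set
CT-Q = (f : ℕ → ℕ) → Σ Form λ φ → Σ₁ φ × BoundedF 2 φ ×
       ((n : ℕ) → Q ⊩ ∀' (φ [ num n ] ⇔ num (f n) == x₀))

HA-inseparable : Form → Form → Set₁
HA-inseparable α β =
  (HA ⊩ ¬' (∃' (α ∧' β))) ×
  ((D : ℕ → Set) →
     (∀ n → Q ⊩ α [ num n ] → D n) →
     (∀ n → Q ⊩ β [ num n ] → ¬ D n) →
     Undecidable D)

-- Soundness of intuitionistic natural deduction for Tarski semantics makes
-- "M ⊨ α(n̄)" a predicate that contains every n with Q ⊢ α(n̄) and, since M
-- validates HA ⊢ ¬∃x. α(x) ∧ β(x), excludes every n with Q ⊢ β(n̄). So it
-- separates the pair and is undecidable. Symmetrically "¬ M ⊨ β(n̄)" separates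
-- the pair, and it would be decidable if "M ⊨ β(n̄)" were.
module Submission where

open import Defs hiding (_⇔_)
open import Data.Bool using (true; false; not)
open import Data.Empty using (⊥-elim)
open import Data.List using (map)
open import Data.List.Relation.Unary.All using (All; _∷_; lookup)
import Data.List.Relation.Unary.All as All
open import Data.List.Relation.Unary.All.Properties using (map⁺)
open import Data.Nat using (ℕ; zero; suc)
open import Data.Product using (_×_; _,_; proj₁; proj₂)
open import Data.Product.Function.NonDependent.Propositional using (_×-⇔_)
open import Data.Product.Function.Dependent.Propositional using (Σ-⇔)
open import Data.Sum using (inj₁; inj₂)
open import Data.Sum.Function.Propositional using (_⊎-⇔_)
open import Function using (_∘_; case_of_)
open import Function.Bundles using (_⇔_; mk⇔; Equivalence)
open import Function.Construct.Identity using (⇔-id; ↠-id)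
open import Function.Related.TypeIsomorphisms using (→-cong-⇔)
open import Relation.Nullary using (¬_)
open import Relation.Binary.PropositionalEquality using (_≡_; refl; trans; cong; cong₂)

open Equivalence using (to; from)

≡-cong-⇔ : ∀ {A : Set} {a a′ b b′ : A} → a ≡ a′ → b ≡ b′ → (a ≡ b) ⇔ (a′ ≡ b′)
≡-cong-⇔ refl refl = ⇔-id _

module Semantics (I : Interp) where
  open Interp I

  eval-substT : ∀ {ρ ρ′} σ → (∀ n → eval I ρ (σ n) ≡ ρ′ n) →
                ∀ t → eval I ρ (substT σ t) ≡ eval I ρ′ t
  eval-substT σ σ≈ (var n)  = σ≈ n
  eval-substT σ σ≈ zer      = refl
  eval-substT σ σ≈ (suc' t) = cong iS (eval-substT σ σ≈ t)
  eval-substT σ σ≈ (t ⊕ u)  = cong₂ iplus (eval-substT σ σ≈ t) (eval-substT σ σ≈ u)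
  eval-substT σ σ≈ (t ⊗ u)  = cong₂ itimes (eval-substT σ σ≈ t) (eval-substT σ σ≈ u)

  eval-shiftT : ∀ d ρ t → eval I (consEnv I d ρ) (shiftT t) ≡ eval I ρ t
  eval-shiftT d ρ = eval-substT _ (λ _ → refl)

  eval-up : ∀ {ρ ρ′} σ → (∀ n → eval I ρ (σ n) ≡ ρ′ n) →
            ∀ d n → eval I (consEnv I d ρ) (up σ n) ≡ consEnv I d ρ′ n
  eval-up σ σ≈ d zero    = refl
  eval-up σ σ≈ d (suc n) = trans (eval-shiftT d _ (σ n)) (σ≈ n)

  sat-substF : ∀ {ρ ρ′} σ → (∀ n → eval I ρ (σ n) ≡ ρ′ n) →
               ∀ φ → sat I ρ (substF σ φ) ⇔ sat I ρ′ φ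
  sat-substF σ σ≈ ⊥'       = ⇔-id _
  sat-substF σ σ≈ (t == u) = ≡-cong-⇔ (eval-substT σ σ≈ t) (eval-substT σ σ≈ u)
  sat-substF σ σ≈ (φ ∧' ψ) = sat-substF σ σ≈ φ ×-⇔ sat-substF σ σ≈ ψ
  sat-substF σ σ≈ (φ ∨' ψ) = sat-substF σ σ≈ φ ⊎-⇔ sat-substF σ σ≈ ψ
  sat-substF σ σ≈ (φ ⇒ ψ)  = →-cong-⇔ (sat-substF σ σ≈ φ) (sat-substF σ σ≈ ψ)
  sat-substF {ρ} {ρ′} σ σ≈ (∀' φ) = mk⇔ (λ f d → to (under d) (f d)) (λ f d → from (under d) (f d))
    where
    under : ∀ d → sat I (consEnv I d ρ) (substF (up σ) φ) ⇔ sat I (consEnv I d ρ′) φ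
    under d = sat-substF (up σ) (eval-up σ σ≈ d) φ
  sat-substF σ σ≈ (∃' φ)   = Σ-⇔ (↠-id D) (λ {d} → sat-substF (up σ) (eval-up σ σ≈ d) φ)

  sat-[] : ∀ φ ρ t → sat I ρ (φ [ t ]) ⇔ sat I (consEnv I (eval I ρ t) ρ) φ
  sat-[] φ ρ t = sat-substF (t ∷ₛ var) eval-∷ₛ φ
    where
    eval-∷ₛ : ∀ n → eval I ρ ((t ∷ₛ var) n) ≡ consEnv I (eval I ρ t) ρ n
    eval-∷ₛ zero    = refl
    eval-∷ₛ (suc n) = refl

  sat-shiftF : ∀ φ d ρ → sat I (consEnv I d ρ) (shiftF φ) ⇔ sat I ρ φ
  sat-shiftF φ d ρ = sat-substF _ (λ _ → refl) φ

  All-sat-shiftF : ∀ {Γ} d ρ → All (sat I ρ) Γ → All (sat I (consEnv I d ρ)) (map shiftF Γ)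
  All-sat-shiftF d ρ = map⁺ ∘ All.map (λ {φ} → from (sat-shiftF φ d ρ))

  sound : ∀ {Γ φ} → Γ ⊢ φ → ∀ ρ → All (sat I ρ) Γ → sat I ρ φ
  sound (ctx φ∈Γ)   ρ Γ⊨ = lookup Γ⊨ φ∈Γ
  sound (⊥E d)      ρ Γ⊨ = ⊥-elim (sound d ρ Γ⊨)
  sound (⇒I d)      ρ Γ⊨ = λ a → sound d ρ (a ∷ Γ⊨)
  sound (⇒E d e)    ρ Γ⊨ = sound d ρ Γ⊨ (sound e ρ Γ⊨)
  sound (∧I d e)    ρ Γ⊨ = sound d ρ Γ⊨ , sound e ρ Γ⊨
  sound (∧E₁ d)     ρ Γ⊨ = proj₁ (sound d ρ Γ⊨)
  sound (∧E₂ d)     ρ Γ⊨ = proj₂ (sound d ρ Γ⊨)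
  sound (∨I₁ d)     ρ Γ⊨ = inj₁ (sound d ρ Γ⊨)
  sound (∨I₂ d)     ρ Γ⊨ = inj₂ (sound d ρ Γ⊨)
  sound (∨E d e f)  ρ Γ⊨ with sound d ρ Γ⊨
  ... | inj₁ a = sound e ρ (a ∷ Γ⊨)
  ... | inj₂ b = sound f ρ (b ∷ Γ⊨)
  sound (∀I d)      ρ Γ⊨ = λ x → sound d (consEnv I x ρ) (All-sat-shiftF x ρ Γ⊨)
  sound (∀E {φ = φ} t d) ρ Γ⊨ = from (sat-[] φ ρ t) (sound d ρ Γ⊨ (eval I ρ t))
  sound (∃I {φ = φ} t d) ρ Γ⊨ = eval I ρ t , to (sat-[] φ ρ t) (sound d ρ Γ⊨)
  sound (∃E {ψ = ψ} d e) ρ Γ⊨ with sound d ρ Γ⊨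
  ... | x , a = to (sat-shiftF ψ x ρ) (sound e (consEnv I x ρ) (a ∷ All-sat-shiftF x ρ Γ⊨))

  ⊩-sound : ∀ {T : Theory} {φ} → (∀ {ψ} → T ψ → ∀ ρ → sat I ρ ψ) → T ⊩ φ → ∀ ρ → sat I ρ φ
  ⊩-sound T⊨ (Γ , T∋Γ , d) ρ = sound d ρ (All.map (λ Tψ → T⊨ Tψ ρ) T∋Γ)

module _ (M : ModelHA) where
  open ModelHA M
  open Semantics interp

  Q-valid : ∀ {φ} → Q φ → M ⊨ φ
  Q-valid (base b) = axioms _ (base b)
  Q-valid case ρ =
    axioms _ (ind (x₀ == zer ∨' ∃' (x₁ == suc' x₀))) ρ (inj₁ refl) (λ d _ → inj₂ (d , refl))

  Q⊩⇒⊨ : ∀ {φ} → Q ⊩ φ → M ⊨ φ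
  Q⊩⇒⊨ = ⊩-sound Q-valid

  ⊨-disjoint : ∀ {α β} t → HA ⊩ ¬' (∃' (α ∧' β)) → M ⊨ (α [ t ]) → ¬ M ⊨ (β [ t ])
  ⊨-disjoint {α} {β} t HA⊢disjoint ⊨α ⊨β =
    ⊩-sound (axioms _) HA⊢disjoint ρ
      (eval interp ρ t , to (sat-[] α ρ t) (⊨α ρ) , to (sat-[] β ρ t) (⊨β ρ))
    where
    ρ : ℕ → Interp.D interp
    ρ _ = Interp.i0 interp

Decidable-¬ : ∀ {P : ℕ → Set} → Decidable P → Decidable (¬_ ∘ P)
Decidable-¬ (f , f-spec) = not ∘ f , λ n → not-spec (f n) (f-spec n)
  where
  not-spec : ∀ {A : Set} b → (A → b ≡ true) × (b ≡ true → A) →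
             (¬ A → not b ≡ true) × (not b ≡ true → ¬ A)
  not-spec true  (_ , true⇒A) = (λ ¬a → ⊥-elim (¬a (true⇒A refl))) , λ ()
  not-spec false (A⇒false , _) = (λ _ → refl) , λ _ a → case A⇒false a of λ ()

lemma7p15 : CT-Q → (M : ModelHA) → (α β : Form) → BoundedF 1 α → BoundedF 1 β → HA-inseparable α β → Undecidable (λ n → M ⊨ (α [ num n ])) × Undecidable (λ n → M ⊨ (β [ num n ]))
lemma7p15 _ M α β _ _ (HA⊢disjoint , inseparable) = α-undecidable , β-undecidable
  where
  α-undecidable : Undecidable (λ n → M ⊨ (α [ num n ]))
  α-undecidable = inseparable _
    (λ _ → Q⊩⇒⊨ M)
    (λ n Q⊢β ⊨α → ⊨-disjoint M (num n) HA⊢disjoint ⊨α (Q⊩⇒⊨ M Q⊢β))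

  β-undecidable : Undecidable (λ n → M ⊨ (β [ num n ]))
  β-undecidable β-decidable = inseparable (λ n → ¬ M ⊨ (β [ num n ]))
    (λ n Q⊢α → ⊨-disjoint M (num n) HA⊢disjoint (Q⊩⇒⊨ M Q⊢α))
    (λ n Q⊢β ⊭β → ⊭β (Q⊩⇒⊨ M Q⊢β))
    (Decidable-¬ β-decidable)
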